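{- Let $X$ be a $B$-term and $T$ a set of $B$-terms such that $X_{(i)}\in T$ for all $i\ge1$ (up to $\beta\eta$-equivalence) and $l(X)-a(X')\ge1$ for every $X'\in T$. Then $X$ does not have the $\rho$-property.
   Context: $B=\lambda f.\lambda g.\lambda x.\, f\,(g\,x)$; $B$-terms are combinatory terms built from $B$ by application. Every $B$-term $Y$ has a $\beta\eta$-normal form $\lambda x_1.\cdots\lambda x_n.\,x_1\,e_1\cdots e_k$ with $e_1,\dots,e_k$ built from variables by application; define $l(Y)=n$ and $a(Y)=k$. For a term $X$ and $k\ge1$, $X_{(k)}$ denotes $X\,X\cdots X$ ($k$ copies, left-associated). $X$ has the $\rho$-property if there are distinct positive integers $i,j$ with $X_{(i)}$ and $X_{(j)}$ $\beta\eta$-equivalent. -}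

module Defs where

open import Data.Nat using (ℕ; zero; suc; _<ᵇ_; _≡ᵇ_; pred; _≤_; _+_)
open import Data.Bool using (if_then_else_)
open import Data.List using (List; []; _∷_; length)
open import Data.List.Relation.Unary.All using (All)
open import Data.Product using (Σ; Σ-syntax; ∃-syntax; _×_)
open import Relation.Binary.PropositionalEquality using (_≡_)
open import Relation.Nullary using (¬_)

infixl 7 _·_
data Λ : Set where
  var : ℕ → Λ
  ƛ_  : Λ → Λ
  _·_ : Λ → Λ → Λ

↑ : ℕ → Λ → Λ
↑ c (var i) = if i <ᵇ c then var i else var (suc i)
↑ c (ƛ M)   = ƛ ↑ (suc c) M
↑ c (M · N) = ↑ c M · ↑ c N

sub : ℕ → Λ → Λ → Λ
sub j N (var i) = if i ≡ᵇ j then N else (if j <ᵇ i then var (pred i) else var i)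
sub j N (ƛ M)   = ƛ sub (suc j) (↑ 0 N) M
sub j N (M · N') = sub j N M · sub j N N'

infix 4 _⟶_
data _⟶_ : Λ → Λ → Set where
  β    : ∀ {M N} → (ƛ M) · N ⟶ sub 0 N M
  η    : ∀ {M} → ƛ (↑ 0 M · var 0) ⟶ M
  ξ    : ∀ {M M'} → M ⟶ M' → ƛ M ⟶ ƛ M'
  appˡ : ∀ {M M' N} → M ⟶ M' → M · N ⟶ M' · N
  appʳ : ∀ {M N N'} → N ⟶ N' → M · N ⟶ M · N'

infix 4 _≈βη_
data _≈βη_ : Λ → Λ → Set where
  step  : ∀ {M N} → M ⟶ N → M ≈βη N
  refl  : ∀ {M} → M ≈βη M
  sym   : ∀ {M N} → M ≈βη N → N ≈βη M
  trans : ∀ {M N P} → M ≈βη N → N ≈βη P → M ≈βη P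

Normal : Λ → Set
Normal M = ∀ N → ¬ (M ⟶ N)

infixl 7 _∙_
data BTerm : Set where
  𝐁   : BTerm
  _∙_ : BTerm → BTerm → BTerm

-- B = λf.λg.λx. f (g x)
⟦_⟧ : BTerm → Λ
⟦ 𝐁 ⟧     = ƛ ƛ ƛ (var 2 · (var 1 · var 0))
⟦ X ∙ Y ⟧ = ⟦ X ⟧ · ⟦ Y ⟧

-- X_(k) = X X ⋯ X (k copies, left-associated), for k ≥ 1.
-- (The value at k = 0 is a junk value X and is never used.)
_₍_₎ : BTerm → ℕ → BTerm
X ₍ zero ₎        = X
X ₍ suc zero ₎    = X
X ₍ suc (suc k) ₎ = X ₍ suc k ₎ ∙ X

data Appl : Λ → Set where
  var : ∀ {i} → Appl (var i)
  app : ∀ {M N} → Appl M → Appl N → Appl (M · N)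

lams : ℕ → Λ → Λ
lams zero    M = M
lams (suc n) M = ƛ lams n M

apps : Λ → List Λ → Λ
apps M []       = M
apps M (e ∷ es) = apps (M · e) es

-- HasNF Y n k : Y has βη-normal form λx₁⋯λxₙ. x₁ e₁ ⋯ e_k
-- (inside n = suc m binders, x₁ is de Bruijn index m).
-- Since βη-normal forms are unique, this determines l(Y) = n and a(Y) = k.
HasNF : BTerm → ℕ → ℕ → Set
HasNF Y n k =
  Σ[ m ∈ ℕ ] Σ[ es ∈ List Λ ]
    n ≡ suc m × length es ≡ k × All Appl es ×
    Normal (lams n (apps (var m) es)) ×
    ⟦ Y ⟧ ≈βη lams n (apps (var m) es)

RhoProperty : BTerm → Set
RhoProperty X = ∃[ i ] ∃[ j ] 1 ≤ i × 1 ≤ j × ¬ (i ≡ j) × ⟦ X ₍ i ₎ ⟧ ≈βη ⟦ X ₍ j ₎ ⟧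

-- βη-conversion is confluent (parallel reduction for β, Hindley–Rosen for β ∪ η), so normal forms
-- are unique. The normal form of a B-term is λx₁⋯λxₙ. t for a binary application tree t whose leaves
-- are x₁, …, xₙ in order, and application of B-terms can be computed on these trees. If every power
-- X₍ᵢ₎ has fewer arguments than X has leaves, the step from X₍ᵢ₎ to X₍ᵢ₊₁₎ never decreases the number
-- of leaves, and while that number stays constant the first argument of the head strictly shrinks.
-- Hence the normal forms of the powers never repeat.

module Submission where

open import Defs
  renaming (refl to ≈-refl; sym to ≈-sym; trans to ≈-trans; β to ⟶β; η to ⟶η; ξ to ⟶ξ; appˡ to ⟶appˡ; appʳ to ⟶appʳ)
open import Data.Bool using (true; false; if_then_else_)
open import Data.Empty using (⊥-elim)
open import Data.List using (List; []; _∷_; _++_; _∷ʳ_; map; length; applyDownFrom)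
open import Data.List.Properties using (length-applyDownFrom; applyDownFrom-∷ʳ; map-applyDownFrom)
open import Data.List.Relation.Unary.All.Properties using (applyDownFrom⁺₂)
open import Data.Nat using (ℕ; zero; suc; pred; _+_; _∸_; _≤_; _<_; _≤′_; ≤′-refl; ≤′-step; z≤n; s≤s; _<ᵇ_; _≡ᵇ_)
open import Data.Nat.Properties
  using (≤-refl; ≤-trans; ≤-antisym; ≤-reflexive; ≤-pred; <⇒≤; <⇒≱; <-irrefl; <-trans; <-cmp; ≤⇒≤′;
         m≤m+n; m≤n+m; m≤n⇒m≤1+n; m≤n⇒m<n∨m≡n; +-monoʳ-≤; +-mono-≤; +-monoʳ-<;
         +-cancelʳ-≤; +-cancelʳ-<; +-cancelˡ-≡; suc-injective; +-comm; +-suc; +-assoc; +-identityʳ;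
         m≤n⇒m∸n≡0; m+[n∸m]≡n; m∸n+n≡m; m<n⇒0<n∸m; module ≤-Reasoning)
open import Data.Product using (∃-syntax; _×_; _,_)
open import Data.Sum using (inj₁; inj₂)
open import Function using (_∘_; id)
open import Function.Definitions using (Injective)
open import Level using (0ℓ)
open import Relation.Binary.Core using (Rel; _⇒_)
open import Relation.Binary.Construct.Closure.Equivalence as Eq using (EqClosure)
open import Relation.Binary.Construct.Closure.Reflexive as Refl using (ReflClosure; refl; [_])
open import Relation.Binary.Construct.Closure.ReflexiveTransitive as Star using (Star; ε; _◅_; _◅◅_)
open import Relation.Binary.Construct.Union using (_∪_)
open import Relation.Binary.Definitions using (tri<; tri≈; tri>)
open import Relation.Binary.PropositionalEquality
  using (_≡_; _≢_; refl; sym; trans; cong; cong₂; _≗_; module ≡-Reasoning)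
  renaming (subst to ≡-subst; subst₂ to ≡-subst₂)
open import Relation.Binary.Rewriting using (Confluent; conf⇒unf)
open import Relation.Nullary using (¬_; contradiction)

module Substitution where

  Ren : Set
  Ren = ℕ → ℕ

  Sub : Set
  Sub = ℕ → Λ

  ext : Ren → Ren
  ext ρ zero    = zero
  ext ρ (suc i) = suc (ρ i)

  ren : Ren → Λ → Λ
  ren ρ (var i) = var (ρ i)
  ren ρ (ƛ M)   = ƛ ren (ext ρ) M
  ren ρ (M · N) = ren ρ M · ren ρ N

  exts : Sub → Sub
  exts σ zero    = var zero
  exts σ (suc i) = ren suc (σ i)

  subst : Sub → Λ → Λ
  subst σ (var i) = σ i
  subst σ (ƛ M)   = ƛ subst (exts σ) M
  subst σ (M · N) = subst σ M · subst σ N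

  infixr 5 _•_
  _•_ : Λ → Sub → Sub
  (N • σ) zero    = N
  (N • σ) (suc i) = σ i

  ext-cong : ∀ {ρ ρ′} → ρ ≗ ρ′ → ext ρ ≗ ext ρ′
  ext-cong e zero    = refl
  ext-cong e (suc i) = cong suc (e i)

  ren-cong : ∀ {ρ ρ′} → ρ ≗ ρ′ → ∀ M → ren ρ M ≡ ren ρ′ M
  ren-cong e (var i) = cong var (e i)
  ren-cong e (ƛ M)   = cong ƛ_ (ren-cong (ext-cong e) M)
  ren-cong e (M · N) = cong₂ _·_ (ren-cong e M) (ren-cong e N)

  exts-cong : ∀ {σ σ′} → σ ≗ σ′ → exts σ ≗ exts σ′
  exts-cong e zero    = refl
  exts-cong e (suc i) = cong (ren suc) (e i)

  subst-cong : ∀ {σ σ′} → σ ≗ σ′ → ∀ M → subst σ M ≡ subst σ′ M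
  subst-cong e (var i) = e i
  subst-cong e (ƛ M)   = cong ƛ_ (subst-cong (exts-cong e) M)
  subst-cong e (M · N) = cong₂ _·_ (subst-cong e M) (subst-cong e N)

  ren-id : ∀ {ρ} → ρ ≗ id → ∀ M → ren ρ M ≡ M
  ren-id e (var i) = cong var (e i)
  ren-id e (ƛ M)   = cong ƛ_ (ren-id (λ { zero → refl ; (suc i) → cong suc (e i) }) M)
  ren-id e (M · N) = cong₂ _·_ (ren-id e M) (ren-id e N)

  subst-id : ∀ {σ} → σ ≗ var → ∀ M → subst σ M ≡ M
  subst-id e (var i) = e i
  subst-id e (ƛ M)   = cong ƛ_ (subst-id (λ { zero → refl ; (suc i) → cong (ren suc) (e i) }) M)
  subst-id e (M · N) = cong₂ _·_ (subst-id e M) (subst-id e N)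

  ren-ren : ∀ ρ ρ′ M → ren ρ (ren ρ′ M) ≡ ren (ρ ∘ ρ′) M
  ren-ren ρ ρ′ (var i) = refl
  ren-ren ρ ρ′ (ƛ M)   =
    cong ƛ_ (trans (ren-ren (ext ρ) (ext ρ′) M) (ren-cong (λ { zero → refl ; (suc i) → refl }) M))
  ren-ren ρ ρ′ (M · N) = cong₂ _·_ (ren-ren ρ ρ′ M) (ren-ren ρ ρ′ N)

  subst-ren : ∀ σ ρ M → subst σ (ren ρ M) ≡ subst (σ ∘ ρ) M
  subst-ren σ ρ (var i) = refl
  subst-ren σ ρ (ƛ M)   =
    cong ƛ_ (trans (subst-ren (exts σ) (ext ρ) M) (subst-cong (λ { zero → refl ; (suc i) → refl }) M))
  subst-ren σ ρ (M · N) = cong₂ _·_ (subst-ren σ ρ M) (subst-ren σ ρ N)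

  ren-subst : ∀ ρ σ M → ren ρ (subst σ M) ≡ subst (ren ρ ∘ σ) M
  ren-subst ρ σ (var i) = refl
  ren-subst ρ σ (ƛ M)   = cong ƛ_ (trans (ren-subst (ext ρ) (exts σ) M) (subst-cong exts-ren M))
    where
    exts-ren : ren (ext ρ) ∘ exts σ ≗ exts (ren ρ ∘ σ)
    exts-ren zero    = refl
    exts-ren (suc i) = trans (ren-ren (ext ρ) suc (σ i)) (sym (ren-ren suc ρ (σ i)))
  ren-subst ρ σ (M · N) = cong₂ _·_ (ren-subst ρ σ M) (ren-subst ρ σ N)

  subst-subst : ∀ σ τ M → subst σ (subst τ M) ≡ subst (subst σ ∘ τ) M
  subst-subst σ τ (var i) = refl
  subst-subst σ τ (ƛ M)   = cong ƛ_ (trans (subst-subst (exts σ) (exts τ) M) (subst-cong exts-subst M))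
    where
    exts-subst : subst (exts σ) ∘ exts τ ≗ exts (subst σ ∘ τ)
    exts-subst zero    = refl
    exts-subst (suc i) = trans (subst-ren (exts σ) suc (τ i)) (sym (ren-subst suc σ (τ i)))
  subst-subst σ τ (M · N) = cong₂ _·_ (subst-subst σ τ M) (subst-subst σ τ N)

  ren-as-subst : ∀ ρ M → ren ρ M ≡ subst (var ∘ ρ) M
  ren-as-subst ρ M = trans (sym (subst-id (λ _ → refl) (ren ρ M))) (subst-ren var ρ M)

  subst-ren-suc : ∀ N M → subst (N • var) (ren suc M) ≡ M
  subst-ren-suc N M = trans (subst-ren (N • var) suc M) (subst-id (λ _ → refl) M)

  ren-subst₀ : ∀ ρ N M → ren ρ (subst (N • var) M) ≡ subst (ren ρ N • var) (ren (ext ρ) M)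
  ren-subst₀ ρ N M =
    trans (ren-subst ρ (N • var) M)
      (trans (subst-cong (λ { zero → refl ; (suc i) → refl }) M) (sym (subst-ren (ren ρ N • var) (ext ρ) M)))

  subst-subst₀ : ∀ σ N M → subst σ (subst (N • var) M) ≡ subst (subst σ N • var) (subst (exts σ) M)
  subst-subst₀ σ N M =
    trans (subst-subst σ (N • var) M) (trans (subst-cong commute M) (sym (subst-subst (subst σ N • var) (exts σ) M)))
    where
    commute : subst σ ∘ (N • var) ≗ subst (subst σ N • var) ∘ exts σ
    commute zero    = refl
    commute (suc i) = sym (subst-ren-suc (subst σ N) (σ i))

  shift : ℕ → Ren
  shift c i = if i <ᵇ c then i else suc i

  ↑≡ren : ∀ c M → ↑ c M ≡ ren (shift c) M
  ↑≡ren c (var i) with i <ᵇ c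
  ... | true  = refl
  ... | false = refl
  ↑≡ren c (ƛ M)   = cong ƛ_ (trans (↑≡ren (suc c) M) (sym (ren-cong ext-shift M)))
    where
    ext-shift : ext (shift c) ≗ shift (suc c)
    ext-shift zero    = refl
    ext-shift (suc i) with i <ᵇ c
    ... | true  = refl
    ... | false = refl
  ↑≡ren c (M · N) = cong₂ _·_ (↑≡ren c M) (↑≡ren c N)

  ↑0≡ren-suc : ∀ M → ↑ 0 M ≡ ren suc M
  ↑0≡ren-suc M = trans (↑≡ren 0 M) (ren-cong (λ _ → refl) M)

  subAt : ℕ → Λ → Sub
  subAt j N i = if i ≡ᵇ j then N else (if j <ᵇ i then var (pred i) else var i)

  exts-subAt : ∀ j N → exts (subAt j N) ≗ subAt (suc j) (↑ 0 N)
  exts-subAt j N zero    = refl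
  exts-subAt j N (suc i) with i ≡ᵇ j
  ... | true  = sym (↑0≡ren-suc N)
  ... | false = lift-other j i
    where
    lift-other : ∀ j i → ren suc (if j <ᵇ i then var (pred i) else var i) ≡ (if j <ᵇ i then var i else var (suc i))
    lift-other j zero    = refl
    lift-other j (suc i) with j <ᵇ suc i
    ... | true  = refl
    ... | false = refl

  sub≡subst : ∀ j N M → sub j N M ≡ subst (subAt j N) M
  sub≡subst j N (var i)  = refl
  sub≡subst j N (ƛ M)    = cong ƛ_ (trans (sub≡subst (suc j) (↑ 0 N) M) (sym (subst-cong (exts-subAt j N) M)))
  sub≡subst j N (M · M′) = cong₂ _·_ (sub≡subst j N M) (sub≡subst j N M′)

  sub0≡subst : ∀ N M → sub 0 N M ≡ subst (N • var) M
  sub0≡subst N M = trans (sub≡subst 0 N M) (subst-cong (λ { zero → refl ; (suc i) → refl }) M)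

module Commutation {A : Set} where

  Commute : Rel A 0ℓ → Rel A 0ℓ → Set
  Commute R S = ∀ {a b c} → Star R a b → Star S a c → ∃[ d ] (Star S b d × Star R c d)

  StronglyCommute : Rel A 0ℓ → Rel A 0ℓ → Set
  StronglyCommute R S = ∀ {a b c} → R a b → S a c → ∃[ d ] (Star S b d × ReflClosure R c d)

  reflClosure⇒star : ∀ {R : Rel A 0ℓ} {a b} → ReflClosure R a b → Star R a b
  reflClosure⇒star refl  = ε
  reflClosure⇒star [ r ] = r ◅ ε

  module _ {R S : Rel A 0ℓ} (strong : StronglyCommute R S) where

    private
      strip : ∀ {a b c} → ReflClosure R a b → Star S a c → ∃[ d ] (Star S b d × ReflClosure R c d)
      strip refl  ss      = _ , ss , refl
      strip [ r ] ε       = _ , ε , [ r ]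
      strip [ r ] (s ◅ ss) with strong r s
      ... | _ , ss₁ , r₁ with strip r₁ ss
      ... | d , ss₂ , r₂ = d , ss₁ ◅◅ ss₂ , r₂

    stronglyCommute⇒commute : Commute R S
    stronglyCommute⇒commute ε        ss = _ , ss , ε
    stronglyCommute⇒commute (r ◅ rs) ss with strip [ r ] ss
    ... | _ , ss₁ , r₁ with stronglyCommute⇒commute rs ss₁
    ... | d , ss₂ , rs₂ = d , ss₂ , reflClosure⇒star r₁ ◅◅ rs₂

  module _ {R S : Rel A 0ℓ} (R-conf : Confluent R) (S-conf : Confluent S) (RS : Commute R S) where

    private
      data RS* : Rel A 0ℓ where
        _⨾_ : ∀ {a b c} → Star R a b → Star S b c → RS* a c

      RS*-diamond : ∀ {a b c} → RS* a b → RS* a c → ∃[ d ] (RS* b d × RS* c d)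
      RS*-diamond (r₁ ⨾ s₁) (r₂ ⨾ s₂) with R-conf r₁ r₂
      ... | _ , r₁′ , r₂′ with RS r₁′ s₁ | RS r₂′ s₂
      ... | _ , s₁′ , r₁″ | _ , s₂′ , r₂″ with S-conf s₁′ s₂′
      ... | d , s₁″ , s₂″ = d , r₁″ ⨾ s₁″ , r₂″ ⨾ s₂″

      RS*-confluent : Confluent RS*
      RS*-confluent = stronglyCommute⇒commute diamond
        where
        diamond : StronglyCommute RS* RS*
        diamond x y with RS*-diamond x y
        ... | d , p , q = d , p ◅ ε , [ q ]

      step⇒RS* : (R ∪ S) ⇒ RS*
      step⇒RS* (inj₁ r) = (r ◅ ε) ⨾ ε
      step⇒RS* (inj₂ s) = ε ⨾ (s ◅ ε)

      RS*⇒steps : RS* ⇒ Star (R ∪ S)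
      RS*⇒steps (rs ⨾ ss) = Star.map inj₁ rs ◅◅ Star.map inj₂ ss

      unfold : Star RS* ⇒ Star (R ∪ S)
      unfold xs = Star.concat (Star.map RS*⇒steps xs)

    ∪-confluent : Confluent (R ∪ S)
    ∪-confluent xs ys with RS*-confluent (Star.map step⇒RS* xs) (Star.map step⇒RS* ys)
    ... | d , p , q = d , unfold p , unfold q

module Beta where

  open Substitution
  open Commutation

  infix 4 _→β_ _⇛_ _→β*_

  data _→β_ : Λ → Λ → Set where
    β    : ∀ {M N} → (ƛ M) · N →β subst (N • var) M
    ξ    : ∀ {M M′} → M →β M′ → ƛ M →β ƛ M′
    appˡ : ∀ {M M′ N} → M →β M′ → M · N →β M′ · N
    appʳ : ∀ {M N N′} → N →β N′ → M · N →β M · N′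

  _→β*_ : Λ → Λ → Set
  _→β*_ = Star _→β_

  ƛ-→β* : ∀ {M M′} → M →β* M′ → ƛ M →β* ƛ M′
  ƛ-→β* = Star.gmap ƛ_ ξ

  appˡ-→β* : ∀ {M M′ N} → M →β* M′ → M · N →β* M′ · N
  appˡ-→β* = Star.gmap (_· _) appˡ

  appʳ-→β* : ∀ {M N N′} → N →β* N′ → M · N →β* M · N′
  appʳ-→β* = Star.gmap (_ ·_) appʳ

  data _⇛_ : Λ → Λ → Set where
    var  : ∀ {i} → var i ⇛ var i
    ƛ_   : ∀ {M M′} → M ⇛ M′ → ƛ M ⇛ ƛ M′
    _·_  : ∀ {M M′ N N′} → M ⇛ M′ → N ⇛ N′ → M · N ⇛ M′ · N′
    β    : ∀ {M M′ N N′} → M ⇛ M′ → N ⇛ N′ → (ƛ M) · N ⇛ subst (N′ • var) M′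

  ⇛-refl : ∀ M → M ⇛ M
  ⇛-refl (var i) = var
  ⇛-refl (ƛ M)   = ƛ ⇛-refl M
  ⇛-refl (M · N) = ⇛-refl M · ⇛-refl N

  ⇛-ren : ∀ ρ {M M′} → M ⇛ M′ → ren ρ M ⇛ ren ρ M′
  ⇛-ren ρ var       = var
  ⇛-ren ρ (ƛ p)     = ƛ ⇛-ren (ext ρ) p
  ⇛-ren ρ (p · q)   = ⇛-ren ρ p · ⇛-ren ρ q
  ⇛-ren ρ (β {M′ = M′} {N′ = N′} p q) =
    ≡-subst (_ ⇛_) (sym (ren-subst₀ ρ N′ M′)) (β (⇛-ren (ext ρ) p) (⇛-ren ρ q))

  ⇛-exts : ∀ {σ σ′} → (∀ i → σ i ⇛ σ′ i) → ∀ i → exts σ i ⇛ exts σ′ i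
  ⇛-exts h zero    = var
  ⇛-exts h (suc i) = ⇛-ren suc (h i)

  ⇛-subst : ∀ {σ σ′} → (∀ i → σ i ⇛ σ′ i) → ∀ {M M′} → M ⇛ M′ → subst σ M ⇛ subst σ′ M′
  ⇛-subst h (var {i}) = h i
  ⇛-subst h (ƛ p)     = ƛ ⇛-subst (⇛-exts h) p
  ⇛-subst h (p · q)   = ⇛-subst h p · ⇛-subst h q
  ⇛-subst {σ′ = σ′} h (β {M′ = M′} {N′ = N′} p q) =
    ≡-subst (_ ⇛_) (sym (subst-subst₀ σ′ N′ M′)) (β (⇛-subst (⇛-exts h) p) (⇛-subst h q))

  develop : Λ → Λ
  develop (var i)           = var i
  develop (ƛ M)             = ƛ develop M
  develop ((ƛ M) · N)       = subst (develop N • var) (develop M)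
  develop (var i · N)       = var i · develop N
  develop ((M · M′) · N)    = develop (M · M′) · develop N

  ⇛-develop : ∀ {M N} → M ⇛ N → N ⇛ develop M
  ⇛-develop var                   = var
  ⇛-develop (ƛ p)                 = ƛ ⇛-develop p
  ⇛-develop (_·_ {var i} var q)   = var · ⇛-develop q
  ⇛-develop (_·_ {M · M′} p q)    = ⇛-develop p · ⇛-develop q
  ⇛-develop (_·_ {ƛ M} (ƛ p) q)   = β (⇛-develop p) (⇛-develop q)
  ⇛-develop (β p q)               = ⇛-subst [ ⇛-develop q ,var] (⇛-develop p)
    where
    [_,var] : ∀ {N N′} → N ⇛ N′ → ∀ i → (N • var) i ⇛ (N′ • var) i
    [ q ,var] zero    = q
    [ q ,var] (suc i) = var

  ⇛-confluent : Confluent _⇛_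
  ⇛-confluent = stronglyCommute⇒commute (λ p q → _ , ⇛-develop p ◅ ε , [ ⇛-develop q ])

  →β⇒⇛ : ∀ {M N} → M →β N → M ⇛ N
  →β⇒⇛ β        = β (⇛-refl _) (⇛-refl _)
  →β⇒⇛ (ξ s)    = ƛ →β⇒⇛ s
  →β⇒⇛ (appˡ s) = →β⇒⇛ s · ⇛-refl _
  →β⇒⇛ (appʳ s) = ⇛-refl _ · →β⇒⇛ s

  ⇛⇒→β* : ∀ {M N} → M ⇛ N → M →β* N
  ⇛⇒→β* var     = ε
  ⇛⇒→β* (ƛ p)   = ƛ-→β* (⇛⇒→β* p)
  ⇛⇒→β* (p · q) = appˡ-→β* (⇛⇒→β* p) ◅◅ appʳ-→β* (⇛⇒→β* q)
  ⇛⇒→β* (β p q) = appˡ-→β* (ƛ-→β* (⇛⇒→β* p)) ◅◅ appʳ-→β* (⇛⇒→β* q) ◅◅ β ◅ ε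

  →β-confluent : Confluent _→β_
  →β-confluent p q with ⇛-confluent (Star.map →β⇒⇛ p) (Star.map →β⇒⇛ q)
  ... | d , p′ , q′ = d , Star.concat (Star.map ⇛⇒→β* p′) , Star.concat (Star.map ⇛⇒→β* q′)

module Eta where

  open Substitution
  open Commutation
  open Beta

  infix 4 _→η_ _→η*_

  data _→η_ : Λ → Λ → Set where
    η    : ∀ {M M′} → M′ ≡ ren suc M → ƛ (M′ · var 0) →η M
    ξ    : ∀ {M M′} → M →η M′ → ƛ M →η ƛ M′
    appˡ : ∀ {M M′ N} → M →η M′ → M · N →η M′ · N
    appʳ : ∀ {M N N′} → N →η N′ → M · N →η M · N′

  _→η*_ : Λ → Λ → Set
  _→η*_ = Star _→η_

  ƛ-→η* : ∀ {M M′} → M →η* M′ → ƛ M →η* ƛ M′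
  ƛ-→η* = Star.gmap ƛ_ ξ

  appˡ-→η* : ∀ {M M′ N} → M →η* M′ → M · N →η* M′ · N
  appˡ-→η* = Star.gmap (_· _) appˡ

  appʳ-→η* : ∀ {M N N′} → N →η* N′ → M · N →η* M · N′
  appʳ-→η* = Star.gmap (_ ·_) appʳ

  ƛ-injective : ∀ {M N : Λ} → ƛ M ≡ ƛ N → M ≡ N
  ƛ-injective refl = refl

  ·-injectiveˡ : ∀ {M N M′ N′ : Λ} → M · N ≡ M′ · N′ → M ≡ M′
  ·-injectiveˡ refl = refl

  ·-injectiveʳ : ∀ {M N M′ N′ : Λ} → M · N ≡ M′ · N′ → N ≡ N′
  ·-injectiveʳ refl = refl

  ext-injective : ∀ {ρ} → Injective _≡_ _≡_ ρ → Injective _≡_ _≡_ (ext ρ)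
  ext-injective inj {zero}  {zero}  e = refl
  ext-injective inj {suc i} {suc j} e = cong suc (inj (suc-injective e))

  var-injective : ∀ {i j} → var i ≡ var j → i ≡ j
  var-injective refl = refl

  ren-injective : ∀ {ρ} → Injective _≡_ _≡_ ρ → Injective _≡_ _≡_ (ren ρ)
  ren-injective inj {var i}  {var j}  e = cong var (inj (var-injective e))
  ren-injective inj {ƛ M}    {ƛ N}    e = cong ƛ_ (ren-injective (ext-injective inj) (ƛ-injective e))
  ren-injective inj {M · M′} {N · N′} e =
    cong₂ _·_ (ren-injective inj (·-injectiveˡ e)) (ren-injective inj (·-injectiveʳ e))

  MeetWithin : Ren → Ren → Ren → Set
  MeetWithin ρ π σ = ∀ i j → ρ i ≡ π j → ∃[ k ] i ≡ σ k

  ext-meetWithin : ∀ {ρ π σ} → MeetWithin ρ π σ → MeetWithin (ext ρ) (ext π) (ext σ)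
  ext-meetWithin meet zero    zero    e = zero , refl
  ext-meetWithin meet (suc i) (suc j) e with meet i j (suc-injective e)
  ... | k , refl = suc k , refl

  ren-strengthen : ∀ {ρ π σ} → MeetWithin ρ π σ → ∀ A P → ren ρ A ≡ ren π P → ∃[ A′ ] A ≡ ren σ A′
  ren-strengthen meet (var a) (var p) e with meet a p (var-injective e)
  ... | k , refl = var k , refl
  ren-strengthen meet (ƛ A) (ƛ P) e with ren-strengthen (ext-meetWithin meet) A P (ƛ-injective e)
  ... | A′ , refl = ƛ A′ , refl
  ren-strengthen meet (A · B) (P · Q) e
    with ren-strengthen meet A P (·-injectiveˡ e) | ren-strengthen meet B Q (·-injectiveʳ e)
  ... | A′ , refl | B′ , refl = A′ · B′ , refl

  ren-ext-suc : ∀ ρ M → ren (ext ρ) (ren suc M) ≡ ren suc (ren ρ M)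
  ren-ext-suc ρ M = trans (ren-ren (ext ρ) suc M) (sym (ren-ren suc ρ M))

  ext-meetWithin-suc : ∀ ρ → MeetWithin (ext ρ) suc suc
  ext-meetWithin-suc ρ (suc i) j e = i , refl

  ext≡0 : ∀ {ρ} c → ext ρ c ≡ 0 → c ≡ 0
  ext≡0 zero e = refl

  →η-ren-inv : ∀ {ρ} → Injective _≡_ _≡_ ρ → ∀ M {X R} → X ≡ ren ρ M → X →η R →
               ∃[ M′ ] R ≡ ren ρ M′ × M →η M′
  →η-ren-inv {ρ} inj (ƛ (B · var c)) e (η {M = A} e′) with ext≡0 c (sym (var-injective (·-injectiveʳ (ƛ-injective e))))
  ... | refl with ren-strengthen (ext-meetWithin-suc ρ) B A (trans (sym (·-injectiveˡ (ƛ-injective e))) e′)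
  ... | B′ , refl =
    B′ , ren-injective suc-injective (trans (sym e′) (trans (·-injectiveˡ (ƛ-injective e)) (ren-ext-suc ρ B′))) , η refl
  →η-ren-inv inj (ƛ M)   refl (ξ s) with →η-ren-inv (ext-injective inj) M refl s
  ... | M′ , refl , s′ = ƛ M′ , refl , ξ s′
  →η-ren-inv inj (M · N) refl (appˡ s) with →η-ren-inv inj M refl s
  ... | M′ , refl , s′ = M′ · N , refl , appˡ s′
  →η-ren-inv inj (M · N) refl (appʳ s) with →η-ren-inv inj N refl s
  ... | N′ , refl , s′ = M · N′ , refl , appʳ s′

  →η-stronglyCommute : StronglyCommute _→η_ _→η_
  →η-stronglyCommute (η {M = A} e₁) (η {M = A′} e₂) with ren-injective suc-injective (trans (sym e₁) e₂)
  ... | refl = A , ε , refl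
  →η-stronglyCommute (η {M = A} e) (ξ (appˡ s)) with →η-ren-inv suc-injective A e s
  ... | A′ , refl , s′ = A′ , s′ ◅ ε , [ η refl ]
  →η-stronglyCommute (ξ (appˡ s)) (η {M = A} e) with →η-ren-inv suc-injective A e s
  ... | A′ , refl , s′ = A′ , η refl ◅ ε , [ s′ ]
  →η-stronglyCommute (ξ s) (ξ t) with →η-stronglyCommute s t
  ... | d , p , q = ƛ d , ƛ-→η* p , Refl.map {f = ƛ_} ξ q
  →η-stronglyCommute (appˡ s) (appˡ t) with →η-stronglyCommute s t
  ... | d , p , q = d · _ , appˡ-→η* p , Refl.map {f = _· _} appˡ q
  →η-stronglyCommute (appʳ s) (appʳ t) with →η-stronglyCommute s t
  ... | d , p , q = _ · d , appʳ-→η* p , Refl.map {f = _ ·_} appʳ q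
  →η-stronglyCommute (appˡ s) (appʳ t) = _ , appʳ t ◅ ε , [ appˡ s ]
  →η-stronglyCommute (appʳ s) (appˡ t) = _ , appˡ t ◅ ε , [ appʳ s ]

  →η-confluent : Confluent _→η_
  →η-confluent = stronglyCommute⇒commute →η-stronglyCommute

  →η-ren : ∀ ρ {M N} → M →η N → ren ρ M →η ren ρ N
  →η-ren ρ (η {M = A} refl) = η (ren-ext-suc ρ A)
  →η-ren ρ (ξ s)            = ξ (→η-ren (ext ρ) s)
  →η-ren ρ (appˡ s)         = appˡ (→η-ren ρ s)
  →η-ren ρ (appʳ s)         = appʳ (→η-ren ρ s)

  →η-subst : ∀ σ {M N} → M →η N → subst σ M →η subst σ N
  →η-subst σ (η {M = A} refl) = η (trans (subst-ren (exts σ) suc A) (sym (ren-subst suc σ A)))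
  →η-subst σ (ξ s)            = ξ (→η-subst (exts σ) s)
  →η-subst σ (appˡ s)         = appˡ (→η-subst σ s)
  →η-subst σ (appʳ s)         = appʳ (→η-subst σ s)

  subst-→η* : ∀ {σ σ′} → (∀ i → σ i →η* σ′ i) → ∀ M → subst σ M →η* subst σ′ M
  subst-→η* h (var i) = h i
  subst-→η* h (ƛ M)   = ƛ-→η* (subst-→η* (λ { zero → ε ; (suc i) → Star.gmap (ren suc) (→η-ren suc) (h i) }) M)
  subst-→η* h (M · N) = appˡ-→η* (subst-→η* h M) ◅◅ appʳ-→η* (subst-→η* h N)

  →β-ren-inv : ∀ ρ M {X R} → X ≡ ren ρ M → X →β R → ∃[ M′ ] R ≡ ren ρ M′ × M →β M′
  →β-ren-inv ρ ((ƛ A) · B) refl β = subst (B • var) A , sym (ren-subst₀ ρ B A) , β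
  →β-ren-inv ρ (ƛ M) refl (ξ s) with →β-ren-inv (ext ρ) M refl s
  ... | M′ , refl , s′ = ƛ M′ , refl , ξ s′
  →β-ren-inv ρ (M · N) refl (appˡ s) with →β-ren-inv ρ M refl s
  ... | M′ , refl , s′ = M′ · N , refl , appˡ s′
  →β-ren-inv ρ (M · N) refl (appʳ s) with →β-ren-inv ρ N refl s
  ... | N′ , refl , s′ = M · N′ , refl , appʳ s′

  subst-var0-ren-ext-suc : ∀ C → subst (var 0 • var) (ren (ext suc) C) ≡ C
  subst-var0-ren-ext-suc C =
    trans (subst-ren (var 0 • var) (ext suc) C) (subst-id (λ { zero → refl ; (suc i) → refl }) C)

  →β→η-stronglyCommute : StronglyCommute _→β_ _→η_
  →β→η-stronglyCommute (β {_ · var 0} {B}) (appˡ (η {M = C} refl)) =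
    C · B , ≡-subst (λ z → z · B →η* C · B) (sym (subst-ren-suc B C)) ε , refl
  →β→η-stronglyCommute (β {A} {B}) (appˡ (ξ {M′ = A′} s)) = subst (B • var) A′ , →η-subst (B • var) s ◅ ε , [ β ]
  →β→η-stronglyCommute (β {A} {B}) (appʳ s) =
    subst (_ • var) A , subst-→η* (λ { zero → s ◅ ε ; (suc i) → ε }) A , [ β ]
  →β→η-stronglyCommute (ξ (β {D})) (η {M = ƛ C} refl) =
    ƛ C , ≡-subst (λ z → ƛ z →η* ƛ C) (sym (subst-var0-ren-ext-suc C)) ε , refl
  →β→η-stronglyCommute (ξ (appˡ s)) (η {M = C} e) with →β-ren-inv suc C e s
  ... | C′ , refl , s′ = C′ , η refl ◅ ε , [ s′ ]
  →β→η-stronglyCommute (ξ s) (ξ t) with →β→η-stronglyCommute s t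
  ... | d , p , q = ƛ d , ƛ-→η* p , Refl.map {f = ƛ_} ξ q
  →β→η-stronglyCommute (appˡ s) (appˡ t) with →β→η-stronglyCommute s t
  ... | d , p , q = d · _ , appˡ-→η* p , Refl.map {f = _· _} appˡ q
  →β→η-stronglyCommute (appʳ s) (appʳ t) with →β→η-stronglyCommute s t
  ... | d , p , q = _ · d , appʳ-→η* p , Refl.map {f = _ ·_} appʳ q
  →β→η-stronglyCommute (appˡ s) (appʳ t) = _ , appʳ t ◅ ε , [ appˡ s ]
  →β→η-stronglyCommute (appʳ s) (appˡ t) = _ , appˡ t ◅ ε , [ appʳ s ]

  →βη-confluent : Confluent (_→β_ ∪ _→η_)
  →βη-confluent = ∪-confluent →β-confluent →η-confluent (stronglyCommute⇒commute →β→η-stronglyCommute)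

module Conversion where

  open Substitution
  open Beta
  open Eta

  ⟶⇒→βη : ∀ {M N} → M ⟶ N → (_→β_ ∪ _→η_) M N
  ⟶⇒→βη (⟶β {M} {N}) = inj₁ (≡-subst ((ƛ M) · N →β_) (sym (sub0≡subst N M)) β)
  ⟶⇒→βη (⟶η {M})     = inj₂ (η (↑0≡ren-suc M))
  ⟶⇒→βη (⟶ξ s) with ⟶⇒→βη s
  ... | inj₁ r = inj₁ (ξ r)
  ... | inj₂ r = inj₂ (ξ r)
  ⟶⇒→βη (⟶appˡ s) with ⟶⇒→βη s
  ... | inj₁ r = inj₁ (appˡ r)
  ... | inj₂ r = inj₂ (appˡ r)
  ⟶⇒→βη (⟶appʳ s) with ⟶⇒→βη s
  ... | inj₁ r = inj₁ (appʳ r)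
  ... | inj₂ r = inj₂ (appʳ r)

  →β⇒⟶ : ∀ {M N} → M →β N → M ⟶ N
  →β⇒⟶ (β {M} {N}) = ≡-subst ((ƛ M) · N ⟶_) (sub0≡subst N M) ⟶β
  →β⇒⟶ (ξ s)       = ⟶ξ (→β⇒⟶ s)
  →β⇒⟶ (appˡ s)    = ⟶appˡ (→β⇒⟶ s)
  →β⇒⟶ (appʳ s)    = ⟶appʳ (→β⇒⟶ s)

  →η⇒⟶ : ∀ {M N} → M →η N → M ⟶ N
  →η⇒⟶ (η {M} refl) = ≡-subst (λ z → ƛ (z · var 0) ⟶ M) (↑0≡ren-suc M) ⟶η
  →η⇒⟶ (ξ s)        = ⟶ξ (→η⇒⟶ s)
  →η⇒⟶ (appˡ s)     = ⟶appˡ (→η⇒⟶ s)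
  →η⇒⟶ (appʳ s)     = ⟶appʳ (→η⇒⟶ s)

  →βη⇒⟶ : ∀ {M N} → (_→β_ ∪ _→η_) M N → M ⟶ N
  →βη⇒⟶ (inj₁ r) = →β⇒⟶ r
  →βη⇒⟶ (inj₂ r) = →η⇒⟶ r

  ⟶-confluent : Confluent _⟶_
  ⟶-confluent p q with →βη-confluent (Star.map ⟶⇒→βη p) (Star.map ⟶⇒→βη q)
  ... | d , p′ , q′ = d , Star.map →βη⇒⟶ p′ , Star.map →βη⇒⟶ q′

  ≈βη⇒eqClosure : ∀ {M N} → M ≈βη N → EqClosure _⟶_ M N
  ≈βη⇒eqClosure (step s)    = Eq.return s
  ≈βη⇒eqClosure ≈-refl      = ε
  ≈βη⇒eqClosure (≈-sym p)   = Eq.symmetric _⟶_ (≈βη⇒eqClosure p)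
  ≈βη⇒eqClosure (≈-trans p q) = ≈βη⇒eqClosure p ◅◅ ≈βη⇒eqClosure q

  normal-unique : ∀ {M N} → Normal M → Normal N → M ≈βη N → M ≡ N
  normal-unique nM nN p = conf⇒unf ⟶-confluent (λ (_ , s) → nM _ s) (λ (_ , s) → nN _ s) (≈βη⇒eqClosure p)

  ⟶*⇒≈βη : ∀ {M N} → Star _⟶_ M N → M ≈βη N
  ⟶*⇒≈βη ε        = ≈-refl
  ⟶*⇒≈βη (s ◅ ss) = ≈-trans (step s) (⟶*⇒≈βη ss)

  →β*⇒≈βη : ∀ {M N} → M →β* N → M ≈βη N
  →β*⇒≈βη ss = ⟶*⇒≈βη (Star.map →β⇒⟶ ss)

  →η*⇒≈βη : ∀ {M N} → M →η* N → M ≈βη N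
  →η*⇒≈βη ss = ⟶*⇒≈βη (Star.map →η⇒⟶ ss)

module Trees where

  open Substitution

  data Tree : Set where
    leaf : Tree
    node : Tree → Tree → Tree

  leaves : Tree → ℕ
  leaves leaf       = 1
  leaves (node a b) = leaves a + leaves b

  arity : Tree → ℕ
  arity leaf       = 0
  arity (node a b) = suc (arity a)

  -- Leaves are numbered from the right, starting at o.
  fill : Tree → (ℕ → Λ) → ℕ → Λ
  fill leaf       F o = F o
  fill (node a b) F o = fill a F (o + leaves b) · fill b F o

  body : Tree → Λ
  body t = fill t var 0

  -- The normal form λx₁⋯λxₙ. x₁ e₁ ⋯ e_k whose application skeleton is t, the leaves read x₁, …, xₙ.
  ⌜_⌝ : Tree → Λ
  ⌜ t ⌝ = lams (leaves t) (body t)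

  -- Arguments are indexed from the right: arg t 0 is the last one.
  arg : Tree → ℕ → Tree
  arg leaf       j       = leaf
  arg (node a b) zero    = b
  arg (node a b) (suc j) = arg a j

  argOffset : Tree → ℕ → ℕ → ℕ
  argOffset leaf       o j       = o
  argOffset (node a b) o zero    = o
  argOffset (node a b) o (suc j) = argOffset a (o + leaves b) j

  headIndex : Tree → ℕ → ℕ
  headIndex leaf       o = o
  headIndex (node a b) o = headIndex a (o + leaves b)

  args : Tree → (ℕ → Λ) → ℕ → List Λ
  args t F o = applyDownFrom (λ j → fill (arg t j) F (argOffset t o j)) (arity t)

  length-args : ∀ t F o → length (args t F o) ≡ arity t
  length-args t F o = length-applyDownFrom _ (arity t)

  args-node : ∀ a b F o → args (node a b) F o ≡ args a F (o + leaves b) ∷ʳ fill b F o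
  args-node a b F o = sym (applyDownFrom-∷ʳ _ (arity a))

  1≤leaves : ∀ t → 1 ≤ leaves t
  1≤leaves leaf       = s≤s z≤n
  1≤leaves (node a b) = ≤-trans (1≤leaves a) (m≤m+n (leaves a) (leaves b))

  suc-headIndex : ∀ t o → suc (headIndex t o) ≡ o + leaves t
  suc-headIndex leaf       o = +-comm 1 o
  suc-headIndex (node a b) o = begin
    suc (headIndex a (o + leaves b))  ≡⟨ suc-headIndex a (o + leaves b) ⟩
    o + leaves b + leaves a           ≡⟨ +-assoc o (leaves b) (leaves a) ⟩
    o + (leaves b + leaves a)         ≡⟨ cong (o +_) (+-comm (leaves b) (leaves a)) ⟩
    o + (leaves a + leaves b)         ∎
    where open ≡-Reasoning

  apps-∷ʳ : ∀ M xs x → apps M (xs ∷ʳ x) ≡ apps M xs · x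
  apps-∷ʳ M []       x = refl
  apps-∷ʳ M (y ∷ xs) x = apps-∷ʳ (M · y) xs x

  apps-++ : ∀ M xs ys → apps M (xs ++ ys) ≡ apps (apps M xs) ys
  apps-++ M []       ys = refl
  apps-++ M (x ∷ xs) ys = apps-++ (M · x) xs ys

  fillHead : Tree → Λ → (ℕ → Λ) → ℕ → Λ
  fillHead leaf       h F o = h
  fillHead (node a b) h F o = fillHead a h F (o + leaves b) · fill b F o

  fill≡fillHead : ∀ t F o → fill t F o ≡ fillHead t (F (headIndex t o)) F o
  fill≡fillHead leaf       F o = refl
  fill≡fillHead (node a b) F o = cong (_· fill b F o) (fill≡fillHead a F (o + leaves b))

  fillHead-spine : ∀ t h F o → fillHead t h F o ≡ apps h (args t F o)
  fillHead-spine leaf       h F o = refl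
  fillHead-spine (node a b) h F o = begin
    fillHead a h F (o + leaves b) · fill b F o        ≡⟨ cong (_· fill b F o) (fillHead-spine a h F (o + leaves b)) ⟩
    apps h (args a F (o + leaves b)) · fill b F o     ≡⟨ sym (apps-∷ʳ h (args a F (o + leaves b)) _) ⟩
    apps h (args a F (o + leaves b) ∷ʳ fill b F o)    ≡⟨ cong (apps h) (sym (args-node a b F o)) ⟩
    apps h (args (node a b) F o)                      ∎
    where open ≡-Reasoning

  fill-spine : ∀ t F o → fill t F o ≡ apps (F (headIndex t o)) (args t F o)
  fill-spine t F o = trans (fill≡fillHead t F o) (fillHead-spine t _ F o)

  leaves-split : ∀ a b {j} → j < leaves a → leaves b + j < leaves (node a b)
  leaves-split a b {j} j< = begin-strict
    leaves b + j         <⟨ +-monoʳ-< (leaves b) j< ⟩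
    leaves b + leaves a  ≡⟨ +-comm (leaves b) (leaves a) ⟩
    leaves a + leaves b  ∎
    where open ≤-Reasoning

  fill-cong : ∀ t {F G} o q → (∀ j → j < leaves t → F (o + j) ≡ G (q + j)) → fill t F o ≡ fill t G q
  fill-cong leaf {F} {G} o q h = ≡-subst₂ (λ x y → F x ≡ G y) (+-identityʳ o) (+-identityʳ q) (h 0 (s≤s z≤n))
  fill-cong (node a b) {F} {G} o q h = cong₂ _·_ (fill-cong a (o + leaves b) (q + leaves b) onA) (fill-cong b o q onB)
    where
    onA : ∀ j → j < leaves a → F (o + leaves b + j) ≡ G (q + leaves b + j)
    onA j j< = ≡-subst₂ (λ x y → F x ≡ G y) (sym (+-assoc o (leaves b) j)) (sym (+-assoc q (leaves b) j))
                 (h (leaves b + j) (leaves-split a b j<))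
    onB : ∀ j → j < leaves b → F (o + j) ≡ G (q + j)
    onB j j< = h j (≤-trans j< (m≤n+m (leaves b) (leaves a)))

  fillHead-cong : ∀ t h {F G} o q → (∀ j → suc j < leaves t → F (o + j) ≡ G (q + j)) →
                  fillHead t h F o ≡ fillHead t h G q
  fillHead-cong leaf       h     o q eq = refl
  fillHead-cong (node a b) h {F} {G} o q eq =
    cong₂ _·_ (fillHead-cong a h (o + leaves b) (q + leaves b) onA) (fill-cong b o q onB)
    where
    onA : ∀ j → suc j < leaves a → F (o + leaves b + j) ≡ G (q + leaves b + j)
    onA j j< = ≡-subst₂ (λ x y → F x ≡ G y) (sym (+-assoc o (leaves b) j)) (sym (+-assoc q (leaves b) j))
                 (eq (leaves b + j) (≡-subst (_< leaves (node a b)) (+-suc (leaves b) j) (leaves-split a b j<)))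
    onB : ∀ j → j < leaves b → F (o + j) ≡ G (q + j)
    onB j j< = eq j (≤-trans (s≤s j<)
                 (≡-subst (λ x → x < leaves (node a b)) (+-identityʳ (leaves b)) (leaves-split a b (1≤leaves a))))

  subst-fill : ∀ σ t F o → subst σ (fill t F o) ≡ fill t (subst σ ∘ F) o
  subst-fill σ leaf       F o = refl
  subst-fill σ (node a b) F o = cong₂ _·_ (subst-fill σ a F (o + leaves b)) (subst-fill σ b F o)

  fill-appl : ∀ t o → Appl (fill t var o)
  fill-appl leaf       o = var
  fill-appl (node a b) o = app (fill-appl a (o + leaves b)) (fill-appl b o)

module Abstraction where

  open Substitution
  open Beta
  open Trees

  extsⁿ : ℕ → Sub → Sub
  extsⁿ zero    σ = σ
  extsⁿ (suc n) σ = exts (extsⁿ n σ)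

  subst-lams : ∀ n σ B → subst σ (lams n B) ≡ lams n (subst (extsⁿ n σ) B)
  subst-lams zero    σ B = refl
  subst-lams (suc n) σ B = cong ƛ_ (trans (subst-lams n (exts σ) B) (cong (lams n) (subst-cong (extsⁿ-exts n) B)))
    where
    extsⁿ-exts : ∀ n → extsⁿ n (exts σ) ≗ exts (extsⁿ n σ)
    extsⁿ-exts zero    i = refl
    extsⁿ-exts (suc n)   = exts-cong (extsⁿ-exts n)

  extsⁿ-bound : ∀ n σ j → j < n → extsⁿ n σ j ≡ var j
  extsⁿ-bound (suc n) σ zero    p       = refl
  extsⁿ-bound (suc n) σ (suc j) (s≤s p) = cong (ren suc) (extsⁿ-bound n σ j p)

  extsⁿ-free : ∀ n σ p → extsⁿ n σ (n + p) ≡ ren (n +_) (σ p)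
  extsⁿ-free zero    σ p = sym (ren-id (λ _ → refl) (σ p))
  extsⁿ-free (suc n) σ p = trans (cong (ren suc) (extsⁿ-free n σ p)) (ren-ren suc (n +_) (σ p))

  subst-⌜⌝ : ∀ σ t → subst σ ⌜ t ⌝ ≡ ⌜ t ⌝
  subst-⌜⌝ σ t = trans (subst-lams (leaves t) σ (body t)) (cong (lams (leaves t))
    (trans (subst-fill (extsⁿ (leaves t) σ) t var 0) (fill-cong t 0 0 (λ j → extsⁿ-bound (leaves t) σ j))))

  ren-⌜⌝ : ∀ ρ t → ren ρ ⌜ t ⌝ ≡ ⌜ t ⌝
  ren-⌜⌝ ρ t = trans (ren-as-subst ρ ⌜ t ⌝) (subst-⌜⌝ (var ∘ ρ) t)

  argsSub : List Λ → Sub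
  argsSub []       = var
  argsSub (a ∷ as) = subst (argsSub as) ∘ extsⁿ (length as) (a • var)

  apps-→β : ∀ {M M′} xs → M →β M′ → apps M xs →β apps M′ xs
  apps-→β []       s = s
  apps-→β (x ∷ xs) s = apps-→β xs (appˡ s)

  apps-→β* : ∀ {M M′} xs → M →β* M′ → apps M xs →β* apps M′ xs
  apps-→β* xs = Star.gmap (λ M → apps M xs) (apps-→β xs)

  lams-→β* : ∀ n {M M′} → M →β* M′ → lams n M →β* lams n M′
  lams-→β* n = Star.gmap (lams n) (lams-→β n)
    where
    lams-→β : ∀ n {M M′} → M →β M′ → lams n M →β lams n M′
    lams-→β zero    s = s
    lams-→β (suc n) s = ξ (lams-→β n s)

  apps-lams-→β* : ∀ as B → apps (lams (length as) B) as →β* subst (argsSub as) B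
  apps-lams-→β* []       B = ≡-subst (B →β*_) (sym (subst-id (λ _ → refl) B)) ε
  apps-lams-→β* (a ∷ as) B = apps-→β as β ◅ ≡-subst₂ _→β*_
    (cong (λ z → apps z as) (sym (subst-lams (length as) (a • var) B)))
    (subst-subst (argsSub as) (extsⁿ (length as) (a • var)) B)
    (apps-lams-→β* as (subst (extsⁿ (length as) (a • var)) B))

  argsSub-free : ∀ as q → argsSub as (length as + q) ≡ var q
  argsSub-free []       q = refl
  argsSub-free (a ∷ as) q = begin
    subst (argsSub as) (extsⁿ (length as) (a • var) (suc (length as + q)))
      ≡⟨ cong (subst (argsSub as) ∘ extsⁿ (length as) (a • var)) (sym (+-suc (length as) q)) ⟩
    subst (argsSub as) (extsⁿ (length as) (a • var) (length as + suc q))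
      ≡⟨ cong (subst (argsSub as)) (extsⁿ-free (length as) (a • var) (suc q)) ⟩
    subst (argsSub as) (ren (length as +_) (var q))
      ≡⟨ argsSub-free as q ⟩
    var q ∎
    where open ≡-Reasoning

  argsSub-head : ∀ a as → argsSub (a ∷ as) (length as) ≡ a
  argsSub-head a as = begin
    subst (argsSub as) (extsⁿ (length as) (a • var) (length as))
      ≡⟨ cong (subst (argsSub as) ∘ extsⁿ (length as) (a • var)) (sym (+-identityʳ (length as))) ⟩
    subst (argsSub as) (extsⁿ (length as) (a • var) (length as + 0))
      ≡⟨ cong (subst (argsSub as)) (extsⁿ-free (length as) (a • var) 0) ⟩
    subst (argsSub as) (ren (length as +_) a)
      ≡⟨ subst-ren (argsSub as) (length as +_) a ⟩
    subst (argsSub as ∘ (length as +_)) a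
      ≡⟨ subst-id (argsSub-free as) a ⟩
    a ∎
    where open ≡-Reasoning

  argsSub-tail : ∀ a as j → j < length as → argsSub (a ∷ as) j ≡ argsSub as j
  argsSub-tail a as j p = cong (subst (argsSub as)) (extsⁿ-bound (length as) (a • var) j p)

  argsSub-applyDownFrom : ∀ h n j → j < n → argsSub (applyDownFrom h n) j ≡ h j
  argsSub-applyDownFrom h (suc n) j p with <-cmp j n
  ... | tri< j<n _ _ =
    trans (argsSub-tail (h n) (applyDownFrom h n) j (≡-subst (j <_) (sym (length-applyDownFrom h n)) j<n))
          (argsSub-applyDownFrom h n j j<n)
  ... | tri≈ _ refl _ =
    ≡-subst (λ z → argsSub (h j ∷ applyDownFrom h j) z ≡ h j) (length-applyDownFrom h j) (argsSub-head (h j) (applyDownFrom h j))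
  ... | tri> _ _ j>n = contradiction (≤-pred p) (<⇒≱ j>n)

module EtaExpansion where

  open Substitution
  open Eta
  open Conversion
  open Trees

  vars : ℕ → List Λ
  vars = applyDownFrom var

  lams-suc : ∀ n M → lams (suc n) M ≡ lams n (ƛ M)
  lams-suc zero    M = refl
  lams-suc (suc n) M = cong ƛ_ (lams-suc n M)

  lams-→η : ∀ n {M M′} → M →η M′ → lams n M →η lams n M′
  lams-→η zero    s = s
  lams-→η (suc n) s = ξ (lams-→η n s)

  ren-apps : ∀ ρ M xs → ren ρ (apps M xs) ≡ apps (ren ρ M) (map (ren ρ) xs)
  ren-apps ρ M []       = refl
  ren-apps ρ M (x ∷ xs) = ren-apps ρ (M · x) xs

  η-expand-step : ∀ C → ren suc C ≡ C → ∀ n → lams (suc n) (apps C (vars (suc n))) →η lams n (apps C (vars n))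
  η-expand-step C closed n = ≡-subst (_→η lams n (apps C (vars n))) (sym unfold) (lams-→η n (η lifted))
    where
    lifted : apps C (map (ren suc) (vars n)) ≡ ren suc (apps C (vars n))
    lifted = sym (trans (ren-apps suc C (vars n)) (cong (λ z → apps z (map (ren suc) (vars n))) closed))
    open ≡-Reasoning
    unfold : lams (suc n) (apps C (vars (suc n))) ≡ lams n (ƛ (apps C (map (ren suc) (vars n)) · var 0))
    unfold = begin
      lams (suc n) (apps C (vars (suc n)))
        ≡⟨ lams-suc n _ ⟩
      lams n (ƛ apps C (vars (suc n)))
        ≡⟨ cong (λ z → lams n (ƛ apps C z)) (sym (applyDownFrom-∷ʳ Λ.var n)) ⟩
      lams n (ƛ apps C (applyDownFrom (Λ.var ∘ suc) n ∷ʳ var 0))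
        ≡⟨ cong (λ z → lams n (ƛ apps C (z ∷ʳ var 0))) (sym (map-applyDownFrom Λ.var (ren suc) n)) ⟩
      lams n (ƛ apps C (map (ren suc) (vars n) ∷ʳ var 0))
        ≡⟨ cong (λ z → lams n (ƛ z)) (apps-∷ʳ C (map (ren suc) (vars n)) (var 0)) ⟩
      lams n (ƛ (apps C (map (ren suc) (vars n)) · var 0)) ∎

  η-expand : ∀ C → ren suc C ≡ C → ∀ n → C ≈βη lams n (apps C (vars n))
  η-expand C closed zero    = ≈-refl
  η-expand C closed (suc n) = ≈-trans (η-expand C closed n) (≈-sym (step (→η⇒⟶ (η-expand-step C closed n))))

module Grafting where

  open Substitution
  open Beta
  open Trees
  open Abstraction
  open Eta using (_→η_; _→η*_; η)
  open EtaExpansion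
  open Conversion

  graft : Tree → (ℕ → Tree) → ℕ → Tree
  graft leaf       g o = g o
  graft (node a b) g o = node (graft a g (o + leaves b)) (graft b g o)

  leavesBelow : (ℕ → Tree) → ℕ → ℕ
  leavesBelow g zero    = 0
  leavesBelow g (suc j) = leavesBelow g j + leaves (g j)

  leavesBelow-suc : ∀ g j → leavesBelow g (suc j) ≡ leaves (g 0) + leavesBelow (g ∘ suc) j
  leavesBelow-suc g zero    = +-comm 0 (leaves (g 0))
  leavesBelow-suc g (suc j) = trans (cong (_+ leaves (g (suc j))) (leavesBelow-suc g j))
    (+-assoc (leaves (g 0)) (leavesBelow (g ∘ suc) j) (leaves (g (suc j))))

  leaves-graft : ∀ u g o → leaves (graft u g o) + leavesBelow g o ≡ leavesBelow g (o + leaves u)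
  leaves-graft leaf       g o = trans (+-comm (leaves (g o)) (leavesBelow g o)) (cong (leavesBelow g) (+-comm 1 o))
  leaves-graft (node a b) g o = begin
    leaves a′ + leaves b′ + leavesBelow g o      ≡⟨ +-assoc (leaves a′) (leaves b′) (leavesBelow g o) ⟩
    leaves a′ + (leaves b′ + leavesBelow g o)    ≡⟨ cong (leaves a′ +_) (leaves-graft b g o) ⟩
    leaves a′ + leavesBelow g (o + leaves b)     ≡⟨ leaves-graft a g (o + leaves b) ⟩
    leavesBelow g (o + leaves b + leaves a)      ≡⟨ cong (leavesBelow g) (+-assoc o (leaves b) (leaves a)) ⟩
    leavesBelow g (o + (leaves b + leaves a))    ≡⟨ cong (λ x → leavesBelow g (o + x)) (+-comm (leaves b) (leaves a)) ⟩
    leavesBelow g (o + (leaves a + leaves b))    ∎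
    where
    open ≡-Reasoning
    a′ = graft a g (o + leaves b)
    b′ = graft b g o

  fill-graft : ∀ u g o F x → fill (graft u g o) F (x + leavesBelow g o) ≡ fill u (λ j → fill (g j) F (x + leavesBelow g j)) o
  fill-graft leaf       g o F x = refl
  fill-graft (node a b) g o F x = cong₂ _·_
    (trans (cong (fill (graft a g (o + leaves b)) F) offset) (fill-graft a g (o + leaves b) F x))
    (fill-graft b g o F x)
    where
    offset : x + leavesBelow g o + leaves (graft b g o) ≡ x + leavesBelow g (o + leaves b)
    offset = trans (+-assoc x (leavesBelow g o) (leaves (graft b g o)))
      (cong (x +_) (trans (+-comm (leavesBelow g o) (leaves (graft b g o))) (leaves-graft b g o)))

  argOffset≡leavesBelow : ∀ t o j → j < arity t → argOffset t o j ≡ o + leavesBelow (arg t) j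
  argOffset≡leavesBelow (node a b) o zero    p       = sym (+-identityʳ o)
  argOffset≡leavesBelow (node a b) o (suc j) (s≤s p) = trans (argOffset≡leavesBelow a (o + leaves b) j p)
    (trans (+-assoc o (leaves b) (leavesBelow (arg a) j)) (cong (o +_) (sym (leavesBelow-suc (arg (node a b)) j))))

  leaves≡suc-leavesBelow : ∀ t → leaves t ≡ suc (leavesBelow (arg t) (arity t))
  leaves≡suc-leavesBelow leaf       = refl
  leaves≡suc-leavesBelow (node a b) =
    trans (cong (_+ leaves b) (leaves≡suc-leavesBelow a))
      (trans (cong suc (+-comm (leavesBelow (arg a) (arity a)) (leaves b)))
        (cong suc (sym (leavesBelow-suc (arg (node a b)) (arity a)))))

  pad : Tree → ℕ → Tree
  pad t zero    = t
  pad t (suc p) = pad (node t leaf) p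

  leaves-pad : ∀ t p → leaves (pad t p) ≡ leaves t + p
  leaves-pad t zero    = sym (+-identityʳ (leaves t))
  leaves-pad t (suc p) = trans (leaves-pad (node t leaf) p) (+-assoc (leaves t) 1 p)

  arity-pad : ∀ t p → arity (pad t p) ≡ arity t + p
  arity-pad t zero    = sym (+-identityʳ (arity t))
  arity-pad t (suc p) = trans (arity-pad (node t leaf) p) (sym (+-suc (arity t) p))

  -- Intended for arity t ≡ d + leaves u (junk otherwise): ⌜ u ⌝ replaces the head of t and
  -- consumes its first leaves u arguments.
  substHead : Tree → Tree → ℕ → Tree
  substHead u t          zero    = graft u (arg t) 0
  substHead u leaf       (suc d) = leaf
  substHead u (node a b) (suc d) = node (substHead u a d) b

  leaves-substHead : ∀ u t d → arity t ≡ d + leaves u → leaves (substHead u t d) + 1 ≡ leaves t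
  leaves-substHead u t zero e = begin
    leaves (graft u (arg t) 0) + 1                          ≡⟨ cong (_+ 1) (trans (sym (+-identityʳ _)) (leaves-graft u (arg t) 0)) ⟩
    leavesBelow (arg t) (leaves u) + 1                      ≡⟨ +-comm _ 1 ⟩
    suc (leavesBelow (arg t) (leaves u))                    ≡⟨ cong (suc ∘ leavesBelow (arg t)) (sym e) ⟩
    suc (leavesBelow (arg t) (arity t))                     ≡⟨ sym (leaves≡suc-leavesBelow t) ⟩
    leaves t                                                ∎
    where open ≡-Reasoning
  leaves-substHead u (node a b) (suc d) e = begin
    leaves (substHead u a d) + leaves b + 1     ≡⟨ +-assoc (leaves (substHead u a d)) (leaves b) 1 ⟩
    leaves (substHead u a d) + (leaves b + 1)   ≡⟨ cong (leaves (substHead u a d) +_) (+-comm (leaves b) 1) ⟩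
    leaves (substHead u a d) + (1 + leaves b)   ≡⟨ sym (+-assoc (leaves (substHead u a d)) 1 (leaves b)) ⟩
    leaves (substHead u a d) + 1 + leaves b     ≡⟨ cong (_+ leaves b) (leaves-substHead u a d (suc-injective e)) ⟩
    leaves a + leaves b                         ∎
    where open ≡-Reasoning

  ηReduce : Tree → Tree
  ηReduce leaf                = leaf
  ηReduce (node a leaf)       = ηReduce a
  ηReduce (node a (node b c)) = node a (node b c)

  -- Pad t with leaf arguments until ⌜ u ⌝ can consume leaves u of them, substitute, and η-reduce.
  infixl 7 _·ᵗ_
  _·ᵗ_ : Tree → Tree → Tree
  t ·ᵗ u = ηReduce (substHead u (pad t (leaves u ∸ arity t)) (arity t ∸ leaves u))

  subst-argsSub-body : ∀ u t o → arity t ≡ leaves u →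
                       subst (argsSub (args t var o)) (body u) ≡ fill (graft u (arg t) 0) var o
  subst-argsSub-body u t o e = begin
    subst (argsSub (args t var o)) (fill u var 0)
      ≡⟨ subst-fill (argsSub (args t var o)) u var 0 ⟩
    fill u (argsSub (args t var o)) 0
      ≡⟨ fill-cong u 0 0 argument ⟩
    fill u (λ j → fill (arg t j) var (o + leavesBelow (arg t) j)) 0
      ≡⟨ sym (fill-graft u (arg t) 0 var o) ⟩
    fill (graft u (arg t) 0) var (o + 0)
      ≡⟨ cong (fill (graft u (arg t) 0) var) (+-identityʳ o) ⟩
    fill (graft u (arg t) 0) var o ∎
    where
    open ≡-Reasoning
    argument : ∀ j → j < leaves u → argsSub (args t var o) j ≡ fill (arg t j) var (o + leavesBelow (arg t) j)
    argument j j<u = trans (argsSub-applyDownFrom _ (arity t) j j<t) (cong (fill (arg t j) var) (argOffset≡leavesBelow t o j j<t))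
      where
      j<t : j < arity t
      j<t = ≡-subst (j <_) (sym e) j<u

  fillHead-→β* : ∀ u t d o → arity t ≡ d + leaves u → fillHead t ⌜ u ⌝ var o →β* fill (substHead u t d) var o
  fillHead-→β* u t zero o e =
    ≡-subst₂ _→β*_ unfold (subst-argsSub-body u t o e) (apps-lams-→β* (args t var o) (body u))
    where
    unfold : apps (lams (length (args t var o)) (body u)) (args t var o) ≡ fillHead t ⌜ u ⌝ var o
    unfold = trans (cong (λ n → apps (lams n (body u)) (args t var o)) (trans (length-args t var o) e))
                   (sym (fillHead-spine t ⌜ u ⌝ var o))
  fillHead-→β* u (node a b) (suc d) o e = appˡ-→β* (fillHead-→β* u a d (o + leaves b) (suc-injective e))

  ⌜⌝-ηReduce : ∀ t → ⌜ t ⌝ →η* ⌜ ηReduce t ⌝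
  ⌜⌝-ηReduce leaf                = ε
  ⌜⌝-ηReduce (node a (node b c)) = ε
  ⌜⌝-ηReduce (node a leaf)       =
    ≡-subst (_→η ⌜ a ⌝) (sym unfold) (lams-→η (leaves a) (η refl)) ◅ ⌜⌝-ηReduce a
    where
    open ≡-Reasoning
    body-shift : fill a var 1 ≡ ren suc (body a)
    body-shift = sym (begin
      ren suc (fill a var 0)             ≡⟨ ren-as-subst suc (fill a var 0) ⟩
      subst (Λ.var ∘ suc) (fill a var 0)   ≡⟨ subst-fill (Λ.var ∘ suc) a var 0 ⟩
      fill a (Λ.var ∘ suc) 0               ≡⟨ fill-cong a 0 1 (λ j _ → refl) ⟩
      fill a var 1                       ∎)
    unfold : ⌜ node a leaf ⌝ ≡ lams (leaves a) (ƛ (ren suc (body a) · var 0))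
    unfold = begin
      lams (leaves a + 1) (fill a var 1 · var 0)        ≡⟨ cong (λ n → lams n (fill a var 1 · var 0)) (+-comm (leaves a) 1) ⟩
      lams (suc (leaves a)) (fill a var 1 · var 0)      ≡⟨ lams-suc (leaves a) _ ⟩
      lams (leaves a) (ƛ (fill a var 1 · var 0))        ≡⟨ cong (λ M → lams (leaves a) (ƛ (M · var 0))) body-shift ⟩
      lams (leaves a) (ƛ (ren suc (body a) · var 0))    ∎

  apps-⌜⌝-→β* : ∀ t M p n → leaves t ≡ suc n →
                apps ⌜ t ⌝ (M ∷ applyDownFrom (Λ.var ∘ (p +_)) n) →β* fillHead t M var p
  apps-⌜⌝-→β* t M p n e = ≡-subst₂ _→β*_ unfold refill (apps-lams-→β* as (body t))
    where
    open ≡-Reasoning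
    tl = applyDownFrom (Λ.var ∘ (p +_)) n
    as = M ∷ tl
    length-tl : length tl ≡ n
    length-tl = length-applyDownFrom _ n
    unfold : apps (lams (length as) (body t)) as ≡ apps ⌜ t ⌝ as
    unfold = cong (λ k → apps (lams k (body t)) as) (trans (cong suc length-tl) (sym e))
    head : argsSub as (headIndex t 0) ≡ M
    head = begin
      argsSub as (headIndex t 0)   ≡⟨ cong (argsSub as) (suc-injective (trans (suc-headIndex t 0) e)) ⟩
      argsSub as n                 ≡⟨ cong (argsSub as) (sym length-tl) ⟩
      argsSub as (length tl)       ≡⟨ argsSub-head M tl ⟩
      M                            ∎
    others : ∀ j → suc j < leaves t → argsSub as j ≡ var (p + j)
    others j j< = trans (argsSub-tail M tl j (≡-subst (j <_) (sym length-tl) j<n)) (argsSub-applyDownFrom _ n j j<n)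
      where
      j<n : j < n
      j<n = ≤-pred (≡-subst (suc j <_) e j<)
    refill : subst (argsSub as) (body t) ≡ fillHead t M var p
    refill = begin
      subst (argsSub as) (fill t var 0)                              ≡⟨ subst-fill (argsSub as) t var 0 ⟩
      fill t (argsSub as) 0                                          ≡⟨ fill≡fillHead t (argsSub as) 0 ⟩
      fillHead t (argsSub as (headIndex t 0)) (argsSub as) 0         ≡⟨ cong (λ h → fillHead t h (argsSub as) 0) head ⟩
      fillHead t M (argsSub as) 0                                    ≡⟨ fillHead-cong t M 0 p others ⟩
      fillHead t M var p                                             ∎

  apps-fillHead-vars : ∀ t h p → apps (fillHead t h var p) (vars p) ≡ fillHead (pad t p) h var 0
  apps-fillHead-vars t h zero    = refl
  apps-fillHead-vars t h (suc p) =
    trans (cong (λ o → apps (fillHead t h var o · var p) (vars p)) (+-comm 1 p)) (apps-fillHead-vars (node t leaf) h p)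

  applyDownFrom-+ : ∀ {A : Set} (f : ℕ → A) m n → applyDownFrom f (m + n) ≡ applyDownFrom (f ∘ (n +_)) m ++ applyDownFrom f n
  applyDownFrom-+ f zero    n = refl
  applyDownFrom-+ f (suc m) n = cong₂ _∷_ (cong f (+-comm m n)) (applyDownFrom-+ f m n)

  m+[n∸m]≡[m∸n]+n : ∀ m n → m + (n ∸ m) ≡ (m ∸ n) + n
  m+[n∸m]≡[m∸n]+n zero    zero    = refl
  m+[n∸m]≡[m∸n]+n zero    (suc n) = refl
  m+[n∸m]≡[m∸n]+n (suc m) zero    = refl
  m+[n∸m]≡[m∸n]+n (suc m) (suc n) = trans (cong suc (m+[n∸m]≡[m∸n]+n m n)) (sym (+-suc (m ∸ n) n))

  ⌜⌝-·ᵗ : ∀ t u → ⌜ t ⌝ · ⌜ u ⌝ ≈βη ⌜ t ·ᵗ u ⌝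
  ⌜⌝-·ᵗ t u = ≈-trans (η-expand C C-closed N) (≈-trans (→β*⇒≈βη (lams-→β* N reduce)) (→η*⇒≈βη (⌜⌝-ηReduce r)))
    where
    p = leaves u ∸ arity t
    d = arity t ∸ leaves u
    r = substHead u (pad t p) d
    N = leaves r
    n = pred (leaves t)
    C = ⌜ t ⌝ · ⌜ u ⌝
    C-closed : ren suc C ≡ C
    C-closed = cong₂ _·_ (ren-⌜⌝ suc t) (ren-⌜⌝ suc u)
    leaves-t : leaves t ≡ suc n
    leaves-t with leaves t | 1≤leaves t
    ... | suc _ | _ = refl
    arity-padded : arity (pad t p) ≡ d + leaves u
    arity-padded = trans (arity-pad t p) (m+[n∸m]≡[m∸n]+n (arity t) (leaves u))
    N≡n+p : N ≡ n + p
    N≡n+p = suc-injective (trans (+-comm 1 N)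
      (trans (leaves-substHead u (pad t p) d arity-padded) (trans (leaves-pad t p) (cong (_+ p) leaves-t))))
    split : apps C (vars N) ≡ apps (apps ⌜ t ⌝ (⌜ u ⌝ ∷ applyDownFrom (Λ.var ∘ (p +_)) n)) (vars p)
    split = trans (cong (apps C) (trans (cong vars N≡n+p) (applyDownFrom-+ Λ.var n p)))
                  (apps-++ ⌜ t ⌝ (⌜ u ⌝ ∷ applyDownFrom (Λ.var ∘ (p +_)) n) (vars p))
    reduce : apps C (vars N) →β* body r
    reduce = ≡-subst (_→β* body r) (sym split)
      (apps-→β* (vars p) (apps-⌜⌝-→β* t ⌜ u ⌝ p n leaves-t) ◅◅
       ≡-subst (_→β* body r) (sym (apps-fillHead-vars t ⌜ u ⌝ p)) (fillHead-→β* u (pad t p) d 0 arity-padded))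

module NormalForms where

  open Eta using (ƛ-injective; ·-injectiveˡ; ·-injectiveʳ)
  open Conversion
  open Trees
  open Grafting

  data LastArgCompound : Tree → Set where
    compound : ∀ {a b c} → LastArgCompound (node a (node b c))

  nf : BTerm → Tree
  nf 𝐁       = node leaf (node leaf leaf)
  nf (X ∙ Y) = nf X ·ᵗ nf Y

  ·-congˡ : ∀ {M M′ N} → M ≈βη M′ → M · N ≈βη M′ · N
  ·-congˡ (step s)      = step (⟶appˡ s)
  ·-congˡ ≈-refl        = ≈-refl
  ·-congˡ (≈-sym p)     = ≈-sym (·-congˡ p)
  ·-congˡ (≈-trans p q) = ≈-trans (·-congˡ p) (·-congˡ q)

  ·-congʳ : ∀ {M N N′} → N ≈βη N′ → M · N ≈βη M · N′
  ·-congʳ (step s)      = step (⟶appʳ s)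
  ·-congʳ ≈-refl        = ≈-refl
  ·-congʳ (≈-sym p)     = ≈-sym (·-congʳ p)
  ·-congʳ (≈-trans p q) = ≈-trans (·-congʳ p) (·-congʳ q)

  ⟦⟧≈⌜nf⌝ : ∀ X → ⟦ X ⟧ ≈βη ⌜ nf X ⌝
  ⟦⟧≈⌜nf⌝ 𝐁       = ≈-refl
  ⟦⟧≈⌜nf⌝ (X ∙ Y) = ≈-trans (·-congˡ (⟦⟧≈⌜nf⌝ X)) (≈-trans (·-congʳ (⟦⟧≈⌜nf⌝ Y)) (⌜⌝-·ᵗ (nf X) (nf Y)))

  ηReduce-substHead : ∀ {u} → LastArgCompound u → ∀ t d → arity t ≡ d + leaves u →
                      LastArgCompound (ηReduce (substHead u t d))
  ηReduce-substHead compound t                   zero    e = compound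
  ηReduce-substHead c        (node a leaf)       (suc d) e = ηReduce-substHead c a d (suc-injective e)
  ηReduce-substHead c        (node a (node _ _)) (suc d) e = compound

  ·ᵗ-lastArgCompound : ∀ t {u} → LastArgCompound u → LastArgCompound (t ·ᵗ u)
  ·ᵗ-lastArgCompound t {u} c = ηReduce-substHead c (pad t (leaves u ∸ arity t)) (arity t ∸ leaves u)
    (trans (arity-pad t (leaves u ∸ arity t)) (m+[n∸m]≡[m∸n]+n (arity t) (leaves u)))

  nf-lastArgCompound : ∀ X → LastArgCompound (nf X)
  nf-lastArgCompound 𝐁       = compound
  nf-lastArgCompound (X ∙ Y) = ·ᵗ-lastArgCompound (nf X) (nf-lastArgCompound Y)

  appl-normal : ∀ {B} → Appl B → Normal B
  appl-normal (app a b) _ (⟶appˡ s) = appl-normal a _ s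
  appl-normal (app a b) _ (⟶appʳ s) = appl-normal b _ s

  lams-normal : ∀ n {B} → Appl B → (∀ M → B ≢ ↑ 0 M · var 0) → Normal (lams n B)
  lams-normal zero    a noη   = appl-normal a
  lams-normal (suc n) {B} a noη _ = under-ƛ n refl
    where
    under-ƛ : ∀ n {L N} → L ≡ ƛ lams n B → ¬ (L ⟶ N)
    under-ƛ n       e (⟶ξ s)   = lams-normal n a noη _ (≡-subst (_⟶ _) (ƛ-injective e) s)
    under-ƛ zero    e (⟶η {M}) = noη M (sym (ƛ-injective e))
    under-ƛ (suc n) e ⟶η with ƛ-injective e
    ... | ()

  ⌜⌝-normal : ∀ {t} → LastArgCompound t → Normal ⌜ t ⌝
  ⌜⌝-normal {t} compound = lams-normal (leaves t) (fill-appl t 0) (λ M e → last-not-var (·-injectiveʳ e))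
    where
    last-not-var : ∀ {M N i} → M · N ≢ var i
    last-not-var ()

  ⌜⌝-hasNF : ∀ Y {t} → LastArgCompound t → ⟦ Y ⟧ ≈βη ⌜ t ⌝ → HasNF Y (leaves t) (arity t)
  ⌜⌝-hasNF Y {t} c conv =
    headIndex t 0 , args t var 0 , sym (suc-headIndex t 0) , length-args t var 0 ,
    applyDownFrom⁺₂ _ (arity t) (λ j → fill-appl (arg t j) (argOffset t 0 j)) ,
    ≡-subst Normal spine (⌜⌝-normal c) , ≡-subst (⟦ Y ⟧ ≈βη_) spine conv
    where
    spine : ⌜ t ⌝ ≡ lams (leaves t) (apps (var (headIndex t 0)) (args t var 0))
    spine = cong (lams (leaves t)) (fill-spine t var 0)

  appl-not-ƛ : ∀ {B M} → Appl B → B ≢ ƛ M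
  appl-not-ƛ var ()
  appl-not-ƛ (app a b) ()

  lams-injective : ∀ n n′ {B B′} → Appl B → Appl B′ → lams n B ≡ lams n′ B′ → B ≡ B′
  lams-injective zero    zero     a a′ e = e
  lams-injective zero    (suc n′) a a′ e = ⊥-elim (appl-not-ƛ a e)
  lams-injective (suc n) zero     a a′ e = ⊥-elim (appl-not-ƛ a′ (sym e))
  lams-injective (suc n) (suc n′) a a′ e = lams-injective n n′ a a′ (ƛ-injective e)

  fill-injective : ∀ t t′ o → fill t var o ≡ fill t′ var o → t ≡ t′
  fill-injective leaf       leaf         o e = refl
  fill-injective (node a b) (node a′ b′) o e with fill-injective b b′ o (·-injectiveʳ e)
  ... | refl = cong (λ x → node x b) (fill-injective a a′ (o + leaves b) (·-injectiveˡ e))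

  ⌜⌝-injective : ∀ t t′ → ⌜ t ⌝ ≡ ⌜ t′ ⌝ → t ≡ t′
  ⌜⌝-injective t t′ e = fill-injective t t′ 0 (lams-injective (leaves t) (leaves t′) (fill-appl t 0) (fill-appl t′ 0) e)

  nf-respects-≈βη : ∀ X Y → ⟦ X ⟧ ≈βη ⟦ Y ⟧ → nf X ≡ nf Y
  nf-respects-≈βη X Y conv = ⌜⌝-injective (nf X) (nf Y)
    (normal-unique (⌜⌝-normal (nf-lastArgCompound X)) (⌜⌝-normal (nf-lastArgCompound Y))
      (≈-trans (≈-sym (⟦⟧≈⌜nf⌝ X)) (≈-trans conv (⟦⟧≈⌜nf⌝ Y))))

  hasNF-nf : ∀ Y Z → ⟦ Y ⟧ ≈βη ⟦ Z ⟧ → HasNF Y (leaves (nf Z)) (arity (nf Z))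
  hasNF-nf Y Z conv = ⌜⌝-hasNF Y (nf-lastArgCompound Z) (≈-trans conv (⟦⟧≈⌜nf⌝ Z))

module FirstArgument where

  open Trees
  open Grafting
  open NormalForms

  -- The argument applied directly to the head (junk value leaf when there is none).
  firstArg : Tree → Tree
  firstArg leaf                = leaf
  firstArg (node leaf b)       = b
  firstArg (node (node a c) b) = firstArg (node a c)

  firstArg-node : ∀ a b → 1 ≤ arity a → firstArg (node a b) ≡ firstArg a
  firstArg-node (node a c) b _ = refl

  arg-last≡firstArg : ∀ t → 1 ≤ arity t → arg (node t leaf) (arity t) ≡ firstArg t
  arg-last≡firstArg (node leaf b)       _ = refl
  arg-last≡firstArg (node (node a c) b) _ = arg-last≡firstArg (node a c) (s≤s z≤n)

  leaves-firstArg< : ∀ t → 1 ≤ arity t → leaves (firstArg t) < leaves t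
  leaves-firstArg< (node leaf b)       _ = ≤-refl
  leaves-firstArg< (node (node a c) b) _ = ≤-trans (leaves-firstArg< (node a c) (s≤s z≤n)) (m≤m+n _ (leaves b))

  arity<leaves : ∀ t → arity t < leaves t
  arity<leaves leaf       = ≤-refl
  arity<leaves (node a b) = begin-strict
    suc (arity a)        <⟨ s≤s (arity<leaves a) ⟩
    suc (leaves a)       ≡⟨ +-comm 1 (leaves a) ⟩
    leaves a + 1         ≤⟨ +-monoʳ-≤ (leaves a) (1≤leaves b) ⟩
    leaves a + leaves b  ∎
    where open ≤-Reasoning

  lastArgCompound⇒arity+2≤leaves : ∀ {u} → LastArgCompound u → arity u + 2 ≤ leaves u
  lastArgCompound⇒arity+2≤leaves {node a (node b c)} compound =
    +-mono-≤ (arity<leaves a) (+-mono-≤ (1≤leaves b) (1≤leaves c))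

  arity-graft : ∀ u g o → arity (graft u g o) ≡ arity (g (headIndex u o)) + arity u
  arity-graft leaf       g o = sym (+-identityʳ _)
  arity-graft (node a b) g o = trans (cong suc (arity-graft a g (o + leaves b))) (sym (+-suc _ (arity a)))

  firstArg-graft : ∀ u g o → 1 ≤ arity (g (headIndex u o)) → firstArg (graft u g o) ≡ firstArg (g (headIndex u o))
  firstArg-graft leaf                g o _ = refl
  firstArg-graft (node leaf b)       g o p = firstArg-node (g (o + leaves b)) (graft b g o) p
  firstArg-graft (node (node a c) b) g o p = firstArg-graft (node a c) g (o + leaves b) p

  ·ᵗ-short : ∀ t {u} → LastArgCompound u → arity t < leaves u →
             t ·ᵗ u ≡ graft u (arg (pad t (leaves u ∸ arity t))) 0
  ·ᵗ-short t {u@(node _ (node _ _))} compound p rewrite m≤n⇒m∸n≡0 (<⇒≤ p) = refl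

  leaves-·ᵗ : ∀ t {u} → LastArgCompound u → arity t < leaves u → leaves (t ·ᵗ u) + 1 ≡ leaves t + (leaves u ∸ arity t)
  leaves-·ᵗ t {u} c p rewrite ·ᵗ-short t c p =
    trans (leaves-substHead u (pad t (leaves u ∸ arity t)) 0 (trans (arity-pad t _) (m+[n∸m]≡n (<⇒≤ p))))
          (leaves-pad t (leaves u ∸ arity t))

  module Tight (t : Tree) {u : Tree} (c : LastArgCompound u) (tight : suc (arity t) ≡ leaves u) where

    1≤arity : 1 ≤ arity t
    1≤arity = ≤-pred (≤-trans (m≤n+m 2 (arity u)) (≤-trans (lastArgCompound⇒arity+2≤leaves c) (≤-reflexive (sym tight))))

    ·ᵗ≡graft : t ·ᵗ u ≡ graft u (arg (node t leaf)) 0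
    ·ᵗ≡graft = trans (·ᵗ-short t c (≤-reflexive tight))
      (cong (λ p → graft u (arg (pad t p)) 0) (trans (cong (_∸ arity t) (sym tight)) (suc-∸ (arity t))))
      where
      suc-∸ : ∀ k → suc k ∸ k ≡ 1
      suc-∸ zero    = refl
      suc-∸ (suc k) = suc-∸ k

    head-firstArg : arg (node t leaf) (headIndex u 0) ≡ firstArg t
    head-firstArg = trans (cong (arg (node t leaf)) (suc-injective (trans (suc-headIndex u 0) (sym tight))))
                          (arg-last≡firstArg t 1≤arity)

    arity-·ᵗ : arity (t ·ᵗ u) ≡ arity (firstArg t) + arity u
    arity-·ᵗ = begin
      arity (t ·ᵗ u)                                                  ≡⟨ cong arity ·ᵗ≡graft ⟩
      arity (graft u (arg (node t leaf)) 0)                           ≡⟨ arity-graft u _ 0 ⟩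
      arity (arg (node t leaf) (headIndex u 0)) + arity u             ≡⟨ cong (λ a → arity a + arity u) head-firstArg ⟩
      arity (firstArg t) + arity u                                    ∎
      where open ≡-Reasoning

    firstArg-·ᵗ : 1 ≤ arity (firstArg t) → firstArg (t ·ᵗ u) ≡ firstArg (firstArg t)
    firstArg-·ᵗ p = begin
      firstArg (t ·ᵗ u)                                 ≡⟨ cong firstArg ·ᵗ≡graft ⟩
      firstArg (graft u (arg (node t leaf)) 0)          ≡⟨ firstArg-graft u _ 0 (≡-subst (λ a → 1 ≤ arity a) (sym head-firstArg) p) ⟩
      firstArg (arg (node t leaf) (headIndex u 0))      ≡⟨ cong firstArg head-firstArg ⟩
      firstArg (firstArg t)                             ∎
      where open ≡-Reasoning

module Orbits where

  open Trees
  open Grafting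
  open NormalForms
  open FirstArgument

  monotone-return⇒constant : ∀ (f : ℕ → ℕ) → (∀ d → f d ≤ f (suc d)) →
                             ∀ D → f (suc D) ≡ f 0 → ∀ d → d ≤ D → f (suc d) ≡ f d
  monotone-return⇒constant f grows D ret d d≤D =
    ≤-antisym (≤-trans (monotone (≤⇒≤′ (s≤s d≤D))) (≤-trans (≤-reflexive ret) (monotone (≤⇒≤′ z≤n)))) (grows d)
    where
    monotone : ∀ {d e} → d ≤′ e → f d ≤ f e
    monotone ≤′-refl      = ≤-refl
    monotone (≤′-step d≤e) = ≤-trans (monotone d≤e) (grows _)

  descending⇒< : ∀ (f : ℕ → ℕ) D → (∀ d → d ≤ D → f (suc d) < f d) → f (suc D) < f 0
  descending⇒< f zero    dec = dec 0 z≤n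
  descending⇒< f (suc D) dec = <-trans (dec (suc D) ≤-refl) (descending⇒< f D (λ d d≤D → dec d (m≤n⇒m≤1+n d≤D)))

  -- A step adds leaves unless it is tight (arity + 1 ≡ leaves u); two tight steps in a row shrink the first argument.
  ·ᵗ-orbit-no-return : ∀ {u} → LastArgCompound u → (W : ℕ → Tree) → (∀ d → W (suc d) ≡ W d ·ᵗ u) →
                       (∀ d → arity (W d) < leaves u) → ∀ D → W (suc D) ≢ W 0
  ·ᵗ-orbit-no-return {u} c W W-suc short D ret =
    <-irrefl (cong (leaves ∘ firstArg) ret) (descending⇒< (leaves ∘ firstArg ∘ W) D firstArg-shrinks)
    where
    step-leaves : ∀ d → leaves (W (suc d)) + 1 ≡ leaves (W d) + (leaves u ∸ arity (W d))
    step-leaves d rewrite W-suc d = leaves-·ᵗ (W d) c (short d)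

    leaves-grows : ∀ d → leaves (W d) ≤ leaves (W (suc d))
    leaves-grows d = +-cancelʳ-≤ 1 _ _
      (≤-trans (+-monoʳ-≤ (leaves (W d)) (m<n⇒0<n∸m (short d))) (≤-reflexive (sym (step-leaves d))))

    constant⇒tight : ∀ d → leaves (W (suc d)) ≡ leaves (W d) → suc (arity (W d)) ≡ leaves u
    constant⇒tight d e = trans (cong (_+ arity (W d)) one) (m∸n+n≡m (<⇒≤ (short d)))
      where
      one : 1 ≡ leaves u ∸ arity (W d)
      one = +-cancelˡ-≡ (leaves (W d)) _ _ (trans (cong (_+ 1) (sym e)) (step-leaves d))

    tight-before-return : ∀ d → d ≤ D → suc (arity (W d)) ≡ leaves u
    tight-before-return d d≤D =
      constant⇒tight d (monotone-return⇒constant (leaves ∘ W) leaves-grows D (cong leaves ret) d d≤D)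

    tight : ∀ d → d ≤ suc D → suc (arity (W d)) ≡ leaves u
    tight d d≤ with m≤n⇒m<n∨m≡n d≤
    ... | inj₁ (s≤s d≤D) = tight-before-return d d≤D
    ... | inj₂ refl      = trans (cong (suc ∘ arity) ret) (tight-before-return 0 z≤n)

    firstArg-shrinks : ∀ d → d ≤ D → leaves (firstArg (W (suc d))) < leaves (firstArg (W d))
    firstArg-shrinks d d≤D = ≡-subst (λ t → leaves t < leaves (firstArg (W d))) (sym firstArg-step)
      (leaves-firstArg< (firstArg (W d)) nested)
      where
      open Tight (W d) c (tight d (m≤n⇒m≤1+n d≤D))
      arity-step : arity (W (suc d)) ≡ arity (firstArg (W d)) + arity u
      arity-step = trans (cong arity (W-suc d)) arity-·ᵗ
      nested : 1 ≤ arity (firstArg (W d))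
      nested = +-cancelʳ-< (arity u) 0 _ (≤-pred (begin
        2 + arity u                        ≡⟨ +-comm 2 (arity u) ⟩
        arity u + 2                        ≤⟨ lastArgCompound⇒arity+2≤leaves c ⟩
        leaves u                           ≡⟨ sym (tight (suc d) (s≤s d≤D)) ⟩
        suc (arity (W (suc d)))            ≡⟨ cong suc arity-step ⟩
        suc (arity (firstArg (W d)) + arity u) ∎))
        where open ≤-Reasoning
      firstArg-step : firstArg (W (suc d)) ≡ firstArg (firstArg (W d))
      firstArg-step = trans (cong firstArg (W-suc d)) (firstArg-·ᵗ nested)

open Trees
open NormalForms
open Orbits
open Grafting

earlier-power-differs : ∀ X → (∀ i → 1 ≤ i → arity (nf (X ₍ i ₎)) < leaves (nf X)) →
                        ∀ i j → 1 ≤ i → i < j → nf (X ₍ i ₎) ≢ nf (X ₍ j ₎)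
earlier-power-differs X short (suc l) j _ l<j e =
  ·ᵗ-orbit-no-return (nf-lastArgCompound X) W W-suc (λ d → short (suc (l + d)) (s≤s z≤n)) (j ∸ suc (suc l)) returns
  where
  W : ℕ → Tree
  W d = nf (X ₍ suc (l + d) ₎)
  W-suc : ∀ d → W (suc d) ≡ W d ·ᵗ nf X
  W-suc d = cong (λ k → nf (X ₍ suc k ₎)) (+-suc l d)
  returns : W (suc (j ∸ suc (suc l))) ≡ W 0
  returns = trans (cong (λ k → nf (X ₍ k ₎)) (trans (cong suc (+-suc l _)) (m+[n∸m]≡n l<j)))
                 (trans (sym e) (cong (λ k → nf (X ₍ suc k ₎)) (sym (+-identityʳ l))))

distinct-powers : ∀ X → (∀ i → 1 ≤ i → arity (nf (X ₍ i ₎)) < leaves (nf X)) →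
                  ∀ i j → 1 ≤ i → 1 ≤ j → i ≢ j → nf (X ₍ i ₎) ≢ nf (X ₍ j ₎)
distinct-powers X short i j 1≤i 1≤j i≢j with <-cmp i j
... | tri< i<j _ _ = earlier-power-differs X short i j 1≤i i<j
... | tri≈ _ i≡j _ = ⊥-elim (i≢j i≡j)
... | tri> _ _ j<i = earlier-power-differs X short j i 1≤j j<i ∘ sym

theorem3p8 : (X : BTerm) (T : BTerm → Set) →
    (∀ i → 1 ≤ i → ∃[ Y ] (T Y × ⟦ X ₍ i ₎ ⟧ ≈βη ⟦ Y ⟧)) →
    (∀ X' → T X' → ∀ n k n' k' → HasNF X n k → HasNF X' n' k' → k' + 1 ≤ n) →
    ¬ RhoProperty X
theorem3p8 X T powers bound (i , j , 1≤i , 1≤j , i≢j , conv) =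
  distinct-powers X short i j 1≤i 1≤j i≢j (nf-respects-≈βη (X ₍ i ₎) (X ₍ j ₎) conv)
  where
  short : ∀ i → 1 ≤ i → arity (nf (X ₍ i ₎)) < leaves (nf X)
  short i 1≤i with powers i 1≤i
  ... | Y , TY , convY = ≡-subst (_≤ leaves (nf X)) (+-comm (arity (nf (X ₍ i ₎))) 1)
    (bound Y TY _ _ _ _ (hasNF-nf X X ≈-refl) (hasNF-nf Y (X ₍ i ₎) (≈-sym convY)))
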